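{- Let $V$ be a finite set, let $\sigma=(\mathcal O,R,f)$ and $\tau=(\mathcal P,Q,g)$ be companion skeletons over $V$ via the bijection $\eta:V\to V$ (so that its elementwise extension is a faithful correspondence $\mathcal O^\cap\to\mathcal P^\cap$ with $\eta(O_{f(x)})=P_{g(\eta(x))}$ for all $x$), and let $C$ be a companion set with respect to $\mathcal O$ (so $\eta(C)$ is a companion set with respect to $\mathcal P$). Then for every $x\in V$, $|[x]_f\cap C|=|[\eta(x)]_g\cap\eta(C)|$.
   Context: For a function $f:X\to Y$, $[x]_f=\{x'\in X\mid f(x')=f(x)\}$. A skeleton over a finite set $V$ is a triple $(\mathcal O,R,f)$ where $R\subseteq V$, $\mathcal O=\{O_z\mid z\in R\}$ is a family of subsets of $V$ indexed by $R$ with $O_z=O_{z'}$ iff $z=z'$ and $|\mathcal O|\le |V|$, and $f:V\to R$ is a surjection. For a family $\mathcal O\subseteq 2^V$, $\mathcal O^\cap$ is the smallest family containing $\mathcal O$ closed under intersection of two sets; a faithful correspondence is a bijection $\eta:\mathcal O^\cap\to\mathcal P^\cap$ with $|X|=|\eta(X)|$ and $\eta(X\cap Y)=\eta(X)\cap\eta(Y)$. Skeletons $(\mathcal O,R,f)$ over $V$ and $(\mathcal P,Q,g)$ over $W$ are companions if there is a bijection $\eta:V\to W$ whose elementwise extension restricts to a faithful correspondence $\mathcal O^\cap\to\mathcal P^\cap$ and $\eta(O_{f(x)})=P_{g(\eta(x))}$ for all $x\in V$. Companion sets with respect to $\mathcal O$ are the equivalence classes of the relation $x\sim_{\mathcal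 O}y$ iff $\{X\in\mathcal O\mid x\in X\}=\{X\in\mathcal O\mid y\in X\}$. -}

module Defs where

open import Data.Nat using (ℕ)
open import Data.Bool using (Bool)
open import Data.Fin using (Fin; _≟_)
open import Data.Fin.Subset using (Subset; _∈_; _∩_; ∣_∣)
open import Data.Vec using (tabulate; lookup)
open import Data.Product using (Σ; ∃; _×_)
open import Function.Bundles using (_↔_; Inverse)
open import Relation.Binary.PropositionalEquality using (_≡_)
open import Relation.Nullary using (does)

-- A skeleton (𝒪, R, f) over V = Fin n.
-- 𝒪 is given as an indexing O : Fin n → Subset n; only the values on R matter,
-- and O is injective on R (O_z = O_z' iff z = z').  |𝒪| ≤ |V| holds automatically
-- since 𝒪 is indexed by R ⊆ V.  f : V → R is a surjection onto R.
record Skeleton (n : ℕ) : Set where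
  field
    R     : Subset n
    O     : Fin n → Subset n
    O-inj : ∀ z z′ → z ∈ R → z′ ∈ R → O z ≡ O z′ → z ≡ z′
    f     : Fin n → Fin n
    f∈R   : ∀ x → f x ∈ R
    f-surj : ∀ z → z ∈ R → ∃ λ x → f x ≡ z

module _ {n : ℕ} where
  open Skeleton

  data InClosure (σ : Skeleton n) : Subset n → Set where
    base  : ∀ z → z ∈ R σ → InClosure σ (O σ z)
    inter : ∀ {X Y} → InClosure σ X → InClosure σ Y → InClosure σ (X ∩ Y)

  image : Fin n ↔ Fin n → Subset n → Subset n
  image η X = tabulate (λ y → lookup X (Inverse.from η y))

  fiber : (Fin n → Fin n) → Fin n → Subset n
  fiber h x = tabulate (λ x′ → does (h x′ ≟ h x))

  record FaithfulCorr (σ τ : Skeleton n) (η : Fin n ↔ Fin n) : Set where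
    field
      maps-to : ∀ X → InClosure σ X → InClosure τ (image η X)
      onto    : ∀ Y → InClosure τ Y → Σ (Subset n) λ X → InClosure σ X × image η X ≡ Y
      inj     : ∀ X Y → InClosure σ X → InClosure σ Y → image η X ≡ image η Y → X ≡ Y
      size    : ∀ X → InClosure σ X → ∣ X ∣ ≡ ∣ image η X ∣
      ∩-pres  : ∀ X Y → InClosure σ X → InClosure σ Y →
                image η (X ∩ Y) ≡ image η X ∩ image η Y

  record Companions (σ τ : Skeleton n) (η : Fin n ↔ Fin n) : Set where
    field
      faithful : FaithfulCorr σ τ η
      compat   : ∀ x → image η (O σ (f σ x)) ≡ O τ (f τ (Inverse.to η x))

  SameMembers : Skeleton n → Fin n → Fin n → Set
  SameMembers σ x y = ∀ z → z ∈ R σ → (x ∈ O σ z → y ∈ O σ z) × (y ∈ O σ z → x ∈ O σ z)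

  CompanionSet : Skeleton n → Subset n → Set
  CompanionSet σ C = ∃ λ x₀ → ∀ y → (y ∈ C → SameMembers σ x₀ y) × (SameMembers σ x₀ y → y ∈ C)

-- Since O is injective on R, the fiber [x]_f is determined by the set O_{f(x)},
-- and η carries O_{f(x)} to P_{g(η x)}, injectively on 𝒪^∩; hence η maps
-- [x]_f onto [η x]_g.
-- Elementwise images under a bijection preserve intersections and cardinalities,
-- so |[x]_f ∩ C| = |η([x]_f ∩ C)| = |[η x]_g ∩ η(C)|.  This holds for every
-- subset C.
module Submission where

open import Defs
open import Data.Nat using (ℕ; suc)
open import Data.Nat.Properties using (+-0-commutativeMonoid)
open import Data.Bool using (true; false; _∧_; if_then_else_)
open import Data.Fin using (Fin; _≟_)
open import Data.Fin.Subset using (Subset; _∩_; ∣_∣)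
open import Data.Vec using ([]; _∷_; lookup; tabulate)
open import Data.Vec.Properties using (tabulate∘lookup; tabulate-cong; lookup∘tabulate; lookup-zipWith)
open import Function using (_∘_)
open import Function.Bundles using (_↔_; Inverse; _⇔_; mk⇔)
open import Relation.Binary.PropositionalEquality
open import Relation.Nullary.Decidable using (does-⇔)
open import Algebra.Properties.CommutativeMonoid.Sum +-0-commutativeMonoid
  using (sum; sum-permute; sum-cong-≗)

private
  variable n : ℕ

indicator : Subset n → Fin n → ℕ
indicator X i = if lookup X i then 1 else 0

∣∣≡sum-indicator : (X : Subset n) → ∣ X ∣ ≡ sum (indicator X)
∣∣≡sum-indicator []          = refl
∣∣≡sum-indicator (true ∷ X)  = cong suc (∣∣≡sum-indicator X)
∣∣≡sum-indicator (false ∷ X) = ∣∣≡sum-indicator X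

module _ (η : Fin n ↔ Fin n) where
  open Inverse η

  lookup-image : ∀ X y → lookup (image η X) y ≡ lookup X (from y)
  lookup-image X = lookup∘tabulate (lookup X ∘ from)

  image-∩ : ∀ X Y → image η (X ∩ Y) ≡ image η X ∩ image η Y
  image-∩ X Y = trans (tabulate-cong pointwise) (tabulate∘lookup (image η X ∩ image η Y))
    where
    open ≡-Reasoning
    pointwise : ∀ y → lookup (X ∩ Y) (from y) ≡ lookup (image η X ∩ image η Y) y
    pointwise y = begin
      lookup (X ∩ Y) (from y)                          ≡⟨ lookup-zipWith _∧_ (from y) X Y ⟩
      lookup X (from y) ∧ lookup Y (from y)            ≡⟨ cong₂ _∧_ (lookup-image X y) (lookup-image Y y) ⟨
      lookup (image η X) y ∧ lookup (image η Y) y      ≡⟨ lookup-zipWith _∧_ y (image η X) (image η Y) ⟨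
      lookup (image η X ∩ image η Y) y                 ∎

  ∣image∣≡∣∣ : ∀ X → ∣ image η X ∣ ≡ ∣ X ∣
  ∣image∣≡∣∣ X = begin
    ∣ image η X ∣                      ≡⟨ ∣∣≡sum-indicator (image η X) ⟩
    sum (indicator (image η X))        ≡⟨ sum-cong-≗ (cong (if_then 1 else 0) ∘ lookup-image X) ⟩
    sum (indicator X ∘ from)           ≡⟨ sum-permute (indicator X ∘ from) η ⟩
    sum (indicator X ∘ from ∘ to)      ≡⟨ sum-cong-≗ (cong (indicator X) ∘ strictlyInverseʳ) ⟩
    sum (indicator X)                  ≡⟨ ∣∣≡sum-indicator X ⟨
    ∣ X ∣                              ∎
    where open ≡-Reasoning

module _ {σ τ : Skeleton n} {η : Fin n ↔ Fin n} (companions : Companions σ τ η) where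
  open Skeleton
  open Inverse η
  open Companions companions
  open FaithfulCorr faithful
  open ≡-Reasoning

  image-O-f-from : ∀ y → image η (O σ (f σ (from y))) ≡ O τ (f τ y)
  image-O-f-from y = trans (compat (from y)) (cong (O τ ∘ f τ) (strictlyInverseˡ y))

  f-from≡⇔f-to≡ : ∀ x y → f σ (from y) ≡ f σ x ⇔ f τ y ≡ f τ (to x)
  f-from≡⇔f-to≡ x y = mk⇔ forward backward
    where
    forward : f σ (from y) ≡ f σ x → f τ y ≡ f τ (to x)
    forward e = O-inj τ _ _ (f∈R τ y) (f∈R τ (to x)) (begin
      O τ (f τ y)                     ≡⟨ image-O-f-from y ⟨
      image η (O σ (f σ (from y)))    ≡⟨ cong (image η ∘ O σ) e ⟩
      image η (O σ (f σ x))           ≡⟨ compat x ⟩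
      O τ (f τ (to x))                ∎)

    backward : f τ y ≡ f τ (to x) → f σ (from y) ≡ f σ x
    backward e = O-inj σ _ _ (f∈R σ (from y)) (f∈R σ x)
      (inj _ _ (base _ (f∈R σ (from y))) (base _ (f∈R σ x)) (begin
        image η (O σ (f σ (from y)))  ≡⟨ image-O-f-from y ⟩
        O τ (f τ y)                   ≡⟨ cong (O τ) e ⟩
        O τ (f τ (to x))              ≡⟨ compat x ⟨
        image η (O σ (f σ x))         ∎))

  image-fiber : ∀ x → image η (fiber (f σ) x) ≡ fiber (f τ) (to x)
  image-fiber x = tabulate-cong λ y →
    trans (lookup∘tabulate _ (from y))
          (does-⇔ (f-from≡⇔f-to≡ x y) (f σ (from y) ≟ f σ x) (f τ y ≟ f τ (to x)))

lemma3p7 : (n : ℕ) (σ τ : Skeleton n) (η : Fin n ↔ Fin n) →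
           Companions σ τ η →
           (C : Subset n) → CompanionSet σ C →
           (x : Fin n) →
           ∣ fiber (Skeleton.f σ) x ∩ C ∣ ≡ ∣ fiber (Skeleton.f τ) (Inverse.to η x) ∩ image η C ∣
lemma3p7 n σ τ η companions C _ x = begin
  ∣ F ∩ C ∣                  ≡⟨ ∣image∣≡∣∣ η (F ∩ C) ⟨
  ∣ image η (F ∩ C) ∣        ≡⟨ cong ∣_∣ (image-∩ η F C) ⟩
  ∣ image η F ∩ image η C ∣  ≡⟨ cong (λ Y → ∣ Y ∩ image η C ∣) (image-fiber companions x) ⟩
  ∣ fiber (Skeleton.f τ) (Inverse.to η x) ∩ image η C ∣ ∎
  where
  open ≡-Reasoning
  F : Subset n
  F = fiber (Skeleton.f σ) x
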